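{- Let $n\geq 2$ and consider any draw for the two-division tournament described in the context. Among rounds $1,\ldots,2n+1$, there is at most one round in which there are $n$ common fixtures; in every other round there are at most $n-1$ common fixtures.
   Context: There are $2n+2$ clubs labelled $0,1,\ldots,2n+1$. Clubs $0,\ldots,2n-1$ each have one team in division one and one in division two; clubs $2n$ and $2n+1$ have a team in division two only. In a round robin every pair of teams plays exactly once, organised into rounds in which every team plays exactly one match. Division one is a double round robin over rounds $1,\ldots,4n-2$, where rounds $1,\ldots,2n-1$ form a single round robin among its $2n$ teams and for $r=1,\ldots,2n-1$ round $r+(2n-1)$ has exactly the same matches as round $r$. Division two is a single round robin among its $2n+2$ teams played in rounds $1,\ldots,2n+1$. Two clubs $x,y\in\{0,\ldots,2n-1\}$ have a common fixture in round $r$ if their division-one teams and their division-two teams both play each other in round $r$. -}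

module Defs where

open import Data.Nat using (ℕ; _+_; _*_; _∸_; _≤_; _<_)
open import Data.Fin using (Fin; toℕ; _↑ˡ_)
open import Data.Fin.Properties using (_≟_)
open import Data.Nat.Properties using (_<?_)
open import Data.Product using (Σ; _×_; _,_; proj₁; proj₂)
open import Data.List using (List; length; filter; cartesianProduct; allFin)
open import Relation.Binary.PropositionalEquality using (_≡_; _≢_)
open import Relation.Nullary.Decidable using (_×-dec_)

-- A schedule for k teams: for each round (numbered by ℕ, 1-based) the
-- opponent of each team in that round.
Schedule : ℕ → Set
Schedule k = ℕ → Fin k → Fin k

-- In a round every team plays exactly one match: the opponent map is a
-- fixed-point-free involution (i.e. a perfect matching).
IsRound : {k : ℕ} → (Fin k → Fin k) → Set
IsRound {k} f = ((x : Fin k) → f (f x) ≡ x) × ((x : Fin k) → f x ≢ x)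

SingleRoundRobin : (k a b : ℕ) → Schedule k → Set
SingleRoundRobin k a b S =
  ((r : ℕ) → a ≤ r → r ≤ b → IsRound (S r)) ×
  ((x y : Fin k) → x ≢ y →
     Σ ℕ λ r → (a ≤ r) × (r ≤ b) × (S r x ≡ y) ×
       ((r′ : ℕ) → a ≤ r′ → r′ ≤ b → S r′ x ≡ y → r′ ≡ r))

-- Division one (2n teams, clubs 0..2n-1): double round robin over rounds
-- 1..4n-2, rounds 1..2n-1 a single round robin, round r+(2n-1) = round r.
DivisionOne : (n : ℕ) → Schedule (2 * n) → Set
DivisionOne n S =
  SingleRoundRobin (2 * n) 1 (2 * n ∸ 1) S ×
  ((r : ℕ) → 1 ≤ r → r ≤ 2 * n ∸ 1 →
     (x : Fin (2 * n)) → S (r + (2 * n ∸ 1)) x ≡ S r x)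

DivisionTwo : (n : ℕ) → Schedule (2 * n + 2) → Set
DivisionTwo n S = SingleRoundRobin (2 * n + 2) 1 (2 * n + 1) S

-- The division-two team of club x ∈ {0..2n-1} (clubs 2n, 2n+1 are the last
-- two division-two teams).
div2team : (n : ℕ) → Fin (2 * n) → Fin (2 * n + 2)
div2team n x = x ↑ˡ 2

-- Number of common fixtures in round r: the number of unordered pairs
-- {x,y} (counted as x < y) of clubs in 0..2n-1 whose division-one teams
-- play each other and whose division-two teams play each other in round r.
commonFixtures : (n : ℕ) → Schedule (2 * n) → Schedule (2 * n + 2) → ℕ → ℕ
commonFixtures n S1 S2 r =
  length (filter
    (λ p → (toℕ (proj₁ p) <? toℕ (proj₂ p)) ×-dec
           ((S1 r (proj₁ p) ≟ proj₂ p) ×-dec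
            (S2 r (div2team n (proj₁ p)) ≟ div2team n (proj₂ p))))
    (cartesianProduct (allFin (2 * n)) (allFin (2 * n))))

module Submission where

-- Fix a round r ≤ 2n+1.  Division one plays a perfect matching
-- f of its 2n teams in round r (for r ∈ {2n, 2n+1} this is a repeat of
-- round r − (2n−1)), and division two a perfect matching g of its 2n+2
-- teams.  A common fixture is a pair {x, f x} of clubs, written with
-- x < f x, such that g also pairs the division-two teams of x and f x.
-- Exactly half of the 2n clubs are the smaller end of their f-match, so
-- there are at most n common fixtures.  If there are exactly n, then g
-- pairs every club with its f-partner; hence g maps clubs to clubs, so the
-- two extra teams 2n and 2n+1 must play each other.  They meet in only one
-- round of division two, which is therefore the only round with n common
-- fixtures.

open import Data.Nat using (ℕ; zero; suc; _+_; _*_; _∸_; _≤_; _<_; z≤n; s≤s)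
open import Data.Nat.Properties
  using (_<?_; ≤-refl; ≤-trans; ≤-antisym; ≤-reflexive; <-irrefl; <-asym; ≮⇒≥; ≤∧≢⇒<;
         ≰⇒>; _≤?_; <⇒≤; +-mono-≤; +-mono-<-≤; +-mono-≤-<; +-identityʳ; m≤m+n;
         *-cancelˡ-≡; m∸n+n≡m; m<n⇒0<n∸m; ∸-monoˡ-≤; m+n∸m≡n; +-0-commutativeMonoid;
         module ≤-Reasoning)
open import Data.Fin using (Fin; zero; suc; toℕ; _↑ˡ_; _↑ʳ_; splitAt)
open import Data.Fin.Properties
  using (_≟_; toℕ-injective; suc-injective; ↑ʳ-injective; splitAt-↑ˡ; splitAt-↑ʳ;
         splitAt⁻¹-↑ˡ; splitAt⁻¹-↑ʳ)
open import Data.Fin.Permutation using (permutation)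
open import Data.List using (List; _++_; length; filter; cartesianProduct; allFin; tabulate; map)
open import Data.List.Properties using (length-++; filter-++; map-tabulate)
open import Data.Product using (_×_; _,_; proj₁; proj₂)
open import Data.Sum using (inj₁; inj₂)
open import Data.Bool using (if_then_else_)
open import Data.Empty using (⊥-elim)
open import Relation.Nullary using (Dec; yes; no; does; ¬_)
open import Relation.Nullary.Decidable using (_×-dec_)
open import Relation.Unary using (Pred; Decidable)
open import Relation.Binary.PropositionalEquality
  using (_≡_; _≢_; refl; sym; trans; cong; cong₂; subst; subst₂; module ≡-Reasoning)
open import Algebra.Properties.CommutativeMonoid.Sum +-0-commutativeMonoid
  using (sum; sum-syntax; sum-cong-≗; ∑-distrib-+; sum-permute)
open import Data.Nat.Tactic.RingSolver using (solve-∀)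
open import Level using (Level)

open import Defs

private
  variable
    a p q : Level
    m : ℕ

indicator : {A : Set p} → Dec A → ℕ
indicator d = if does d then 1 else 0

indicator-yes : {A : Set p} (d : Dec A) → A → indicator d ≡ 1
indicator-yes (yes _) _ = refl
indicator-yes (no ¬a) a = ⊥-elim (¬a a)

indicator-no : {A : Set p} (d : Dec A) → ¬ A → indicator d ≡ 0
indicator-no (yes a) ¬a = ⊥-elim (¬a a)
indicator-no (no _) _ = refl

indicator-mono : {A : Set p} {B : Set q} (d : Dec A) (e : Dec B) → (A → B) →
                 indicator d ≤ indicator e
indicator-mono (yes a) (yes _) _ = ≤-refl
indicator-mono (yes a) (no ¬b) h = ⊥-elim (¬b (h a))
indicator-mono (no _) _ _ = z≤n

indicator-cong : {A : Set p} {B : Set q} (d : Dec A) (e : Dec B) → (A → B) → (B → A) →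
                 indicator d ≡ indicator e
indicator-cong d e h k = ≤-antisym (indicator-mono d e h) (indicator-mono e d k)

sum-mono : (g h : Fin m → ℕ) → (∀ i → g i ≤ h i) → sum g ≤ sum h
sum-mono {zero} g h le = z≤n
sum-mono {suc m} g h le =
  +-mono-≤ (le zero) (sum-mono (λ i → g (suc i)) (λ i → h (suc i)) (λ i → le (suc i)))

sum-mono-< : (g h : Fin m → ℕ) → (∀ i → g i ≤ h i) → (c : Fin m) → g c < h c →
             sum g < sum h
sum-mono-< g h le zero lt =
  +-mono-<-≤ lt (sum-mono (λ i → g (suc i)) (λ i → h (suc i)) (λ i → le (suc i)))
sum-mono-< g h le (suc c) lt =
  +-mono-≤-< (le zero) (sum-mono-< (λ i → g (suc i)) (λ i → h (suc i)) (λ i → le (suc i)) c lt)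

sum-zero : (h : Fin m → ℕ) → (∀ i → h i ≡ 0) → sum h ≡ 0
sum-zero {zero} h z = refl
sum-zero {suc m} h z rewrite z zero = sum-zero (λ i → h (suc i)) (λ i → z (suc i))

sum-single : (h : Fin m → ℕ) (c : Fin m) → (∀ i → i ≢ c → h i ≡ 0) → sum h ≡ h c
sum-single h zero z =
  trans (cong (h zero +_) (sum-zero (λ i → h (suc i)) (λ i → z (suc i) (λ ()))))
        (+-identityʳ (h zero))
sum-single h (suc c) z rewrite z zero (λ ()) =
  sum-single (λ i → h (suc i)) c (λ i i≢c → z (suc i) (λ e → i≢c (suc-injective e)))

sum-ones : (h : Fin m → ℕ) → (∀ i → h i ≡ 1) → sum h ≡ m
sum-ones {zero} h e = refl
sum-ones {suc m} h e rewrite e zero = cong suc (sum-ones (λ i → h (suc i)) (λ i → e (suc i)))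

count-tabulate : {A : Set a} {P : Pred A p} (P? : Decidable P) (k : Fin m → A) →
                 length (filter P? (tabulate k)) ≡ ∑[ j < m ] indicator (P? (k j))
count-tabulate {m = zero} P? k = refl
count-tabulate {m = suc m} P? k with P? (k zero)
... | yes _ = cong suc (count-tabulate P? (λ j → k (suc j)))
... | no _ = count-tabulate P? (λ j → k (suc j))

count-product : {A B : Set a} {P : Pred (A × B) p} (P? : Decidable P)
                (h : Fin m → A) (ys : List B) →
                length (filter P? (cartesianProduct (tabulate h) ys)) ≡
                ∑[ i < m ] length (filter P? (map (h i ,_) ys))
count-product {m = zero} P? h ys = refl
count-product {m = suc m} P? h ys = begin
  length (filter P? (row ++ rest))                        ≡⟨ cong length (filter-++ P? row rest) ⟩
  length (filter P? row ++ filter P? rest)                ≡⟨ length-++ (filter P? row) ⟩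
  length (filter P? row) + length (filter P? rest)        ≡⟨ cong (length (filter P? row) +_)
                                                                  (count-product P? (λ i → h (suc i)) ys) ⟩
  length (filter P? row) + ∑[ i < m ] length (filter P? (map (h (suc i) ,_) ys)) ∎
  where
  open ≡-Reasoning
  row = map (h zero ,_) ys
  rest = cartesianProduct (tabulate (λ i → h (suc i))) ys

count-graph : (f : Fin m → Fin m) {P : Pred (Fin m × Fin m) p} (P? : Decidable P) →
              (∀ x y → P (x , y) → f x ≡ y) →
              length (filter P? (cartesianProduct (allFin m) (allFin m))) ≡
              ∑[ x < m ] indicator (P? (x , f x))
count-graph {m = m} f P? onGraph = trans (count-product P? (λ i → i) (allFin m))
  (sum-cong-≗ λ x → begin
    length (filter P? (map (x ,_) (allFin m)))    ≡⟨ cong (λ l → length (filter P? l))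
                                                           (map-tabulate (λ j → j) (x ,_)) ⟩
    length (filter P? (tabulate (x ,_)))          ≡⟨ count-tabulate P? (x ,_) ⟩
    ∑[ y < m ] indicator (P? (x , y))             ≡⟨ sum-single _ (f x) (offGraph x) ⟩
    indicator (P? (x , f x))                      ∎)
  where
  open ≡-Reasoning
  offGraph : ∀ x y → y ≢ f x → indicator (P? (x , y)) ≡ 0
  offGraph x y y≢fx = indicator-no (P? (x , y)) (λ pxy → y≢fx (sym (onGraph x y pxy)))

leaders : (Fin m → Fin m) → ℕ
leaders {m} f = ∑[ x < m ] indicator (toℕ x <? toℕ (f x))

-- Halving: a fixed-point-free involution f on Fin m pairs up the points, and
-- f swaps smaller and larger ends, so exactly half of the points lead.
leaders-halve : (f : Fin m → Fin m) → IsRound f → leaders f + leaders f ≡ m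
leaders-halve {m} f (invol , noFix) = begin
  leaders f + leaders f             ≡⟨ cong (leaders f +_) leaders≡followers ⟩
  leaders f + sum follower          ≡⟨ sym (∑-distrib-+ leader follower) ⟩
  ∑[ x < m ] (leader x + follower x) ≡⟨ sum-ones _ oneEnd ⟩
  m                                 ∎
  where
  open ≡-Reasoning
  leader follower : Fin m → ℕ
  leader x = indicator (toℕ x <? toℕ (f x))
  follower x = indicator (toℕ (f x) <? toℕ x)

  oneEnd : ∀ x → leader x + follower x ≡ 1
  oneEnd x with toℕ x <? toℕ (f x) | toℕ (f x) <? toℕ x
  ... | yes x<fx | yes fx<x = ⊥-elim (<-asym x<fx fx<x)
  ... | yes x<fx | no fx≮x  = cong₂ _+_ (indicator-yes (toℕ x <? _) x<fx) (indicator-no (toℕ (f x) <? _) fx≮x)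
  ... | no x≮fx  | yes fx<x = cong₂ _+_ (indicator-no (toℕ x <? _) x≮fx) (indicator-yes (toℕ (f x) <? _) fx<x)
  ... | no x≮fx  | no fx≮x  = ⊥-elim (noFix x (toℕ-injective (≤-antisym (≮⇒≥ x≮fx) (≮⇒≥ fx≮x))))

  -- f is a permutation exchanging leaders and followers.
  leaders≡followers : leaders f ≡ sum follower
  leaders≡followers = begin
    leaders f                        ≡⟨ sum-cong-≗ (λ x → cong (λ y → indicator (toℕ y <? toℕ (f x)))
                                                                (sym (invol x))) ⟩
    ∑[ x < m ] follower (f x)        ≡⟨ sym (sum-permute follower (permutation f f invol invol)) ⟩
    sum follower                     ∎

-- A division-two style schedule on Fin (m + 2): the clubs are the first m
-- teams (x ↑ˡ 2), and there are two extra teams m ↑ʳ 0 and m ↑ʳ 1.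
-- A club x agrees for matchings f of clubs and g of Fin (m + 2) when x
-- leads its f-match and g pairs the same two clubs.
Agree : (Fin m → Fin m) → (Fin (m + 2) → Fin (m + 2)) → Fin m → Set
Agree f g x = (toℕ x < toℕ (f x)) × (g (x ↑ˡ 2) ≡ f x ↑ˡ 2)

agree? : (f : Fin m → Fin m) (g : Fin (m + 2) → Fin (m + 2)) → Decidable (Agree f g)
agree? f g x = (toℕ x <? toℕ (f x)) ×-dec (g (x ↑ˡ 2) ≟ f x ↑ˡ 2)

agreement : (Fin m → Fin m) → (Fin (m + 2) → Fin (m + 2)) → ℕ
agreement {m} f g = ∑[ x < m ] indicator (agree? f g x)

agreement≤leaders : (f : Fin m → Fin m) (g : Fin (m + 2) → Fin (m + 2)) →
                    agreement f g ≤ leaders f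
agreement≤leaders f g = sum-mono _ _ (λ x → indicator-mono (agree? f g x) (toℕ x <? _) proj₁)

leaders-agree : (f : Fin m → Fin m) (g : Fin (m + 2) → Fin (m + 2)) →
                agreement f g ≡ leaders f → ∀ x → toℕ x < toℕ (f x) → Agree f g x
leaders-agree f g full x x<fx with agree? f g x
... | yes agrees = agrees
... | no ¬agrees = ⊥-elim (<-irrefl full (sum-mono-< _ _ agreeBound x strictAt-x))
  where
  agreeBound : ∀ y → indicator (agree? f g y) ≤ indicator (toℕ y <? toℕ (f y))
  agreeBound y = indicator-mono (agree? f g y) (toℕ y <? _) proj₁
  strictAt-x : indicator (agree? f g x) < indicator (toℕ x <? toℕ (f x))
  strictAt-x = subst₂ _<_ (sym (indicator-no (agree? f g x) ¬agrees))
                          (sym (indicator-yes (toℕ x <? _) x<fx)) (s≤s z≤n)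

-- If every f-pair is also a g-pair, then g restricted to the clubs is f:
-- a club that does not lead its match is the partner of one that does.
agreement-full : (f : Fin m → Fin m) (g : Fin (m + 2) → Fin (m + 2)) →
                 IsRound f → IsRound g → agreement f g ≡ leaders f →
                 ∀ x → g (x ↑ˡ 2) ≡ f x ↑ˡ 2
agreement-full f g (invol , noFix) (gInvol , _) full x with toℕ x <? toℕ (f x)
... | yes x<fx = proj₂ (leaders-agree f g full x x<fx)
... | no x≮fx = begin
  g (x ↑ˡ 2)          ≡⟨ cong (λ y → g (y ↑ˡ 2)) (sym (invol x)) ⟩
  g (f (f x) ↑ˡ 2)    ≡⟨ cong g (sym (proj₂ (leaders-agree f g full (f x) fx<ffx))) ⟩
  g (g (f x ↑ˡ 2))    ≡⟨ gInvol (f x ↑ˡ 2) ⟩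
  f x ↑ˡ 2            ∎
  where
  open ≡-Reasoning
  fx<ffx : toℕ (f x) < toℕ (f (f x))
  fx<ffx = subst (λ y → toℕ (f x) < toℕ y) (sym (invol x))
                 (≤∧≢⇒< (≮⇒≥ x≮fx) (λ e → noFix x (toℕ-injective e)))

extras-paired : (g : Fin (m + 2) → Fin (m + 2)) → IsRound g →
                (h : Fin m → Fin m) → (∀ x → g (x ↑ˡ 2) ≡ h x ↑ˡ 2) →
                g (m ↑ʳ zero) ≡ m ↑ʳ suc zero
extras-paired {m} g (gInvol , noFix) h clubsToClubs with splitAt m (g (m ↑ʳ zero)) in eq
... | inj₁ x = ⊥-elim (club≢extra (h x) zero (begin
  h x ↑ˡ 2            ≡⟨ sym (clubsToClubs x) ⟩
  g (x ↑ˡ 2)          ≡⟨ cong g (splitAt⁻¹-↑ˡ eq) ⟩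
  g (g (m ↑ʳ zero))   ≡⟨ gInvol (m ↑ʳ zero) ⟩
  m ↑ʳ zero           ∎))
  where
  open ≡-Reasoning
  club≢extra : (y : Fin m) (j : Fin 2) → y ↑ˡ 2 ≢ m ↑ʳ j
  club≢extra y j e with () ← trans (sym (splitAt-↑ˡ m y 2)) (trans (cong (splitAt m) e) (splitAt-↑ʳ m 2 j))
... | inj₂ zero = ⊥-elim (noFix (m ↑ʳ zero) (sym (splitAt⁻¹-↑ʳ eq)))
... | inj₂ (suc zero) = sym (splitAt⁻¹-↑ʳ eq)

doubleRoundRobin-rounds : {k M : ℕ} (S : Schedule k) → SingleRoundRobin k 1 M S →
  ((r : ℕ) → 1 ≤ r → r ≤ M → (x : Fin k) → S (r + M) x ≡ S r x) →
  (r : ℕ) → 1 ≤ r → r ≤ M + M → IsRound (S r)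
doubleRoundRobin-rounds {M = M} S (rounds , _) repeat r 1≤r r≤2M with r ≤? M
... | yes r≤M = rounds r 1≤r r≤M
... | no r≰M = subst IsRound (cong S r′+M≡r) (transfer (rounds r′ 1≤r′ r′≤M))
  where
  r′ = r ∸ M
  r′+M≡r : r′ + M ≡ r
  r′+M≡r = m∸n+n≡m (<⇒≤ (≰⇒> r≰M))
  1≤r′ : 1 ≤ r′
  1≤r′ = m<n⇒0<n∸m (≰⇒> r≰M)
  r′≤M : r′ ≤ M
  r′≤M = ≤-trans (∸-monoˡ-≤ M r≤2M) (≤-reflexive (m+n∸m≡n M M))
  transfer : IsRound (S r′) → IsRound (S (r′ + M))
  transfer (invol , noFix) =
    (λ x → trans (repeat r′ 1≤r′ r′≤M (S (r′ + M) x))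
                 (trans (cong (S r′) (repeat r′ 1≤r′ r′≤M x)) (invol x))) ,
    (λ x e → noFix x (trans (sym (repeat r′ 1≤r′ r′≤M x)) e))

-- For n ≥ 2 division one lasts long enough to cover every division-two round.
divisionTwo-within-divisionOne : (n : ℕ) → 2 ≤ n → 2 * n + 1 ≤ (2 * n ∸ 1) + (2 * n ∸ 1)
divisionTwo-within-divisionOne (suc zero) (s≤s ())
divisionTwo-within-divisionOne (suc (suc k)) _ =
  subst (2 * (2 + k) + 1 ≤_) (spare k) (m≤m+n (2 * (2 + k) + 1) (k + k + 1))
  where
  -- (2 * (2 + k) ∸ 1) computes to 1 + k + (2 + (k + 0)).
  spare : ∀ k → 2 * (2 + k) + 1 + (k + k + 1) ≡ (1 + k + (2 + (k + 0))) + (1 + k + (2 + (k + 0)))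
  spare = solve-∀

commonFixtures≡agreement : (n : ℕ) (S1 : Schedule (2 * n)) (S2 : Schedule (2 * n + 2)) (r : ℕ) →
                           commonFixtures n S1 S2 r ≡ agreement (S1 r) (S2 r)
commonFixtures≡agreement n S1 S2 r =
  trans (count-graph (S1 r) _ (λ x y fixture → proj₁ (proj₂ fixture)))
        (sum-cong-≗ λ x → indicator-cong (fixture? x) (agree? (S1 r) (S2 r) x)
          (λ (x<fx , _ , same) → x<fx , same) (λ (x<fx , same) → x<fx , refl , same))
  where
  fixture? : ∀ x → Dec ((toℕ x < toℕ (S1 r x)) × (S1 r x ≡ S1 r x) ×
                        (S2 r (div2team n x) ≡ div2team n (S1 r x)))
  fixture? x = (toℕ x <? toℕ (S1 r x)) ×-dec ((S1 r x ≟ S1 r x) ×-dec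
               (S2 r (div2team n x) ≟ div2team n (S1 r x)))

leaders≡half : (n : ℕ) (f : Fin (2 * n) → Fin (2 * n)) → IsRound f → leaders f ≡ n
leaders≡half n f round =
  *-cancelˡ-≡ (leaders f) n 2 (trans (cong (leaders f +_) (+-identityʳ (leaders f)))
                                     (leaders-halve f round))

commonFixtures-bound : (n : ℕ) (S1 : Schedule (2 * n)) (S2 : Schedule (2 * n + 2)) (r : ℕ) →
                       IsRound (S1 r) → commonFixtures n S1 S2 r ≤ n
commonFixtures-bound n S1 S2 r round₁ = begin
  commonFixtures n S1 S2 r   ≡⟨ commonFixtures≡agreement n S1 S2 r ⟩
  agreement (S1 r) (S2 r)    ≤⟨ agreement≤leaders (S1 r) (S2 r) ⟩
  leaders (S1 r)             ≡⟨ leaders≡half n (S1 r) round₁ ⟩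
  n                          ∎
  where open ≤-Reasoning

commonFixtures-maximal : (n : ℕ) (S1 : Schedule (2 * n)) (S2 : Schedule (2 * n + 2)) (r : ℕ) →
                         IsRound (S1 r) → IsRound (S2 r) → commonFixtures n S1 S2 r ≡ n →
                         S2 r (2 * n ↑ʳ zero) ≡ 2 * n ↑ʳ suc zero
commonFixtures-maximal n S1 S2 r round₁ round₂ maximal =
  extras-paired (S2 r) round₂ (S1 r) (agreement-full (S1 r) (S2 r) round₁ round₂ full)
  where
  full : agreement (S1 r) (S2 r) ≡ leaders (S1 r)
  full = trans (sym (commonFixtures≡agreement n S1 S2 r))
               (trans maximal (sym (leaders≡half n (S1 r) round₁)))

lemma3p1 : (n : ℕ) → 2 ≤ n →
    (S1 : Schedule (2 * n)) → (S2 : Schedule (2 * n + 2)) →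
    DivisionOne n S1 → DivisionTwo n S2 →
    ((r : ℕ) → 1 ≤ r → r ≤ 2 * n + 1 → commonFixtures n S1 S2 r ≤ n) ×
    ((r s : ℕ) → 1 ≤ r → r ≤ 2 * n + 1 → 1 ≤ s → s ≤ 2 * n + 1 →
    commonFixtures n S1 S2 r ≡ n → commonFixtures n S1 S2 s ≡ n → r ≡ s)
lemma3p1 n n≥2 S1 S2 (robin₁ , repeat₁) robin₂ =
  (λ r 1≤r r≤ → commonFixtures-bound n S1 S2 r (round₁ r 1≤r r≤)) , atMostOnce
  where
  round₁ : (r : ℕ) → 1 ≤ r → r ≤ 2 * n + 1 → IsRound (S1 r)
  round₁ r 1≤r r≤ = doubleRoundRobin-rounds S1 robin₁ repeat₁ r 1≤r
                      (≤-trans r≤ (divisionTwo-within-divisionOne n n≥2))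

  extrasMeet : (r : ℕ) → 1 ≤ r → r ≤ 2 * n + 1 → commonFixtures n S1 S2 r ≡ n →
               S2 r (2 * n ↑ʳ zero) ≡ 2 * n ↑ʳ suc zero
  extrasMeet r 1≤r r≤ = commonFixtures-maximal n S1 S2 r (round₁ r 1≤r r≤) (proj₁ robin₂ r 1≤r r≤)

  extras-distinct : 2 * n ↑ʳ zero ≢ 2 * n ↑ʳ suc zero
  extras-distinct e with () ← ↑ʳ-injective (2 * n) zero (suc zero) e

  atMostOnce : (r s : ℕ) → 1 ≤ r → r ≤ 2 * n + 1 → 1 ≤ s → s ≤ 2 * n + 1 →
               commonFixtures n S1 S2 r ≡ n → commonFixtures n S1 S2 s ≡ n → r ≡ s
  atMostOnce r s 1≤r r≤ 1≤s s≤ maxR maxS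
    with (_ , _ , _ , _ , onlyMeeting) ← proj₂ robin₂ (2 * n ↑ʳ zero) (2 * n ↑ʳ suc zero) extras-distinct
    = trans (onlyMeeting r 1≤r r≤ (extrasMeet r 1≤r r≤ maxR))
            (sym (onlyMeeting s 1≤s s≤ (extrasMeet s 1≤s s≤ maxS)))
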